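{- Every infinite set $X\subseteq\omega$ has an infinite subset $B$ such that for all infinite $C, D\subseteq B$, it is not the case that $C \le^{ui}_{T} D$.
   Context: $C \le^{ui}_{T} D$ (for $D$ infinite) means there is a single Turing functional $\Phi$ with $\Phi(S)=C$ for every infinite $S\subseteq D$. -}

module Defs where

open import Data.Nat using (ℕ; zero; suc; _≤_; _<_)
open import Data.Bool using (Bool; true; false)
open import Data.Fin using (Fin)
open import Data.Vec using (Vec; []; _∷_; lookup)
open import Data.Product using (Σ; ∃; _×_; _,_)
open import Relation.Binary.PropositionalEquality using (_≡_)

SetN : Set
SetN = ℕ → Bool

χ : SetN → ℕ → ℕ
χ S n with S n
... | true  = 1
... | false = 0

_⊆_ : SetN → SetN → Set
S ⊆ D = ∀ n → S n ≡ true → D n ≡ true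

Infinite : SetN → Set
Infinite S = ∀ n → ∃ λ m → n ≤ m × S m ≡ true

-- Codes of oracle partial recursive functions of the given arity
-- (Kleene's oracle μ-recursive functions = Turing functionals).
data Code : ℕ → Set where
  zer    : ∀ {n} → Code n
  succ   : Code 1
  proj   : ∀ {n} → Fin n → Code n
  oracle : Code 1
  comp   : ∀ {m n} → Code m → Vec (Code n) m → Code n
  prec   : ∀ {n} → Code n → Code (suc (suc n)) → Code (suc n)
  mu     : ∀ {n} → Code (suc n) → Code n

-- Big-step semantics relative to an oracle S:
-- Eval S e xs z  means  Φ_e^S(xs) converges with output z.
mutual
  data Eval (S : SetN) : ∀ {n} → Code n → Vec ℕ n → ℕ → Set where
    ev-zer    : ∀ {n} {xs : Vec ℕ n} → Eval S zer xs 0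
    ev-succ   : ∀ {x} → Eval S succ (x ∷ []) (suc x)
    ev-proj   : ∀ {n} {xs : Vec ℕ n} (i : Fin n) → Eval S (proj i) xs (lookup xs i)
    ev-oracle : ∀ {x} → Eval S oracle (x ∷ []) (χ S x)
    ev-comp   : ∀ {m n} {g : Code m} {hs : Vec (Code n) m} {xs ys z} →
                EvalVec S xs hs ys → Eval S g ys z → Eval S (comp g hs) xs z
    ev-prec0  : ∀ {n} {f : Code n} {g xs z} →
                Eval S f xs z → Eval S (prec f g) (0 ∷ xs) z
    ev-precS  : ∀ {n} {f : Code n} {g xs k z w} →
                Eval S (prec f g) (k ∷ xs) z → Eval S g (k ∷ z ∷ xs) w →
                Eval S (prec f g) (suc k ∷ xs) w
    ev-mu     : ∀ {n} {f : Code (suc n)} {xs z} →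
                Eval S f (z ∷ xs) 0 →
                (∀ y → y < z → ∃ λ v → Eval S f (y ∷ xs) (suc v)) →
                Eval S (mu f) xs z

  data EvalVec (S : SetN) {n : ℕ} (xs : Vec ℕ n) : ∀ {m} → Vec (Code n) m → Vec ℕ m → Set where
    evv-[] : EvalVec S xs [] []
    evv-∷  : ∀ {m} {h : Code n} {hs : Vec (Code n) m} {y ys} →
             Eval S h xs y → EvalVec S xs hs ys → EvalVec S xs (h ∷ hs) (y ∷ ys)

Computes : Code 1 → SetN → SetN → Set
Computes Φ S C = ∀ n → Eval S Φ (n ∷ []) (χ C n)

_≤uiT_ : SetN → SetN → Set
C ≤uiT D = ∃ λ (Φ : Code 1) → ∀ (S : SetN) → Infinite S → S ⊆ D → Computes Φ S C

-- For a code Φ, call an infinite set T Φ-positive if Φ, run with oracle T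
-- minus its least element n, answers 1 at n. Φ-positivity is open, so by the
-- Nash-Williams theorem (proved with Galvin–Prikry acceptance and rejection)
-- every infinite set has an infinite subset homogeneous for it. Fusing over all
-- codes thins X to an increasing sequence h whose tail beyond h (2⌜Φ⌝) is
-- homogeneous for Φ-positivity, and B = {h (2k)}. If Φ witnessed C ≤uiT D for
-- infinite C, D ⊆ B, then {c} ∪ (D above c) would be Φ-positive exactly when
-- c ∈ C. The homogeneous tail contains such sets both for the point
-- h (2⌜Φ⌝ + 1) ∉ B and for large c ∈ C: a contradiction.

module Submission where

open import Defs
open import Level using (0ℓ)
open import Axiom.ExcludedMiddle using (ExcludedMiddle)
open import Axiom.DoubleNegationElimination using (em⇒dne)
open import Data.Bool using (true; false; _∧_; _∨_; not)
open import Data.Bool.Properties using (∨-assoc; ∨-comm; ∨-identityʳ; ∨-zeroʳ; ∧-identityʳ; ∧-zeroʳ)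
open import Data.Empty using (⊥)
open import Data.Fin using (toℕ; fromℕ<)
open import Data.Fin.Properties using (toℕ<n; fromℕ<-toℕ)
open import Data.List using (List; []; _∷_; length)
open import Data.Maybe using (Maybe; just; nothing; zipWith)
import Data.Maybe as Maybe
open import Data.Maybe.Properties using (just-injective)
open import Data.Nat using (ℕ; zero; suc; _+_; _*_; _≤_; _<_; z≤n; s≤s; _⊔_; _≡ᵇ_; _<ᵇ_; _≤ᵇ_)
open import Data.Nat.Properties
open import Data.Nat.Binary as ℕᵇ using (ℕᵇ; 2[1+_]; 1+[2_])
open import Data.Nat.Binary.Properties as ℕᵇ using ()
open import Data.Product using (Σ; ∃; _×_; _,_; proj₁; proj₂)
open import Data.Sum using (_⊎_; inj₁; inj₂)
open import Data.Vec using (Vec; []; _∷_)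
open import Function using (_∘_)
open import Relation.Binary.Definitions using (tri<; tri≈; tri>)
open import Relation.Binary.PropositionalEquality
open import Relation.Nullary using (¬_; yes; no; does; contradiction)
open import Relation.Nullary.Reflects using (Reflects; ofʸ; ofⁿ; fromEquivalence)

-- Decidable sets of natural numbers

infix 4 _∈_
infixl 6 _∪_ _─_

_∈_ : ℕ → SetN → Set
x ∈ S = S x ≡ true

∅ : SetN
∅ _ = false

≡ᵇ-reflects-≡ : ∀ m n → Reflects (m ≡ n) (m ≡ᵇ n)
≡ᵇ-reflects-≡ m n = fromEquivalence (≡ᵇ⇒≡ m n) (≡⇒≡ᵇ m n)

⁅_⁆ : ℕ → SetN
⁅ a ⁆ y = y ≡ᵇ a

_∪_ : SetN → SetN → SetN
(S ∪ T) y = S y ∨ T y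

_─_ : SetN → ℕ → SetN
(S ─ a) y = S y ∧ not (y ≡ᵇ a)

Above : ℕ → SetN → SetN
Above x A y = A y ∧ (x <ᵇ y)

_↾_ : SetN → ℕ → SetN
(S ↾ x) y = S y ∧ (y ≤ᵇ x)

Below : ℕ → SetN → Set
Below m S = ∀ y → y ∈ S → y < m

IsLeast : ℕ → SetN → Set
IsLeast n S = n ∈ S × (∀ y → y ∈ S → n ≤ y)

⊆-refl : ∀ {S} → S ⊆ S
⊆-refl _ p = p

⊆-trans : ∀ {R S T} → R ⊆ S → S ⊆ T → R ⊆ T
⊆-trans R⊆S S⊆T y p = S⊆T y (R⊆S y p)

∈-resp-≗ : ∀ {S T y} → S ≗ T → y ∈ S → y ∈ T
∈-resp-≗ {y = y} S≗T p = trans (sym (S≗T y)) p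

≗-trans : ∀ {R S T : SetN} → R ≗ S → S ≗ T → R ≗ T
≗-trans R≗S S≗T y = trans (R≗S y) (S≗T y)

≗-sym : ∀ {S T : SetN} → S ≗ T → T ≗ S
≗-sym S≗T y = sym (S≗T y)

∉⇒false : ∀ {S y} → ¬ y ∈ S → S y ≡ false
∉⇒false {S} {y} y∉S with S y
... | true = contradiction refl y∉S
... | false = refl

⁅⁆⁺ : ∀ {a} → a ∈ ⁅ a ⁆
⁅⁆⁺ {a} with a ≡ᵇ a | ≡ᵇ-reflects-≡ a a
... | true | _ = refl
... | false | ofⁿ a≢a = contradiction refl a≢a

⁅⁆⁻ : ∀ {a y} → y ∈ ⁅ a ⁆ → y ≡ a
⁅⁆⁻ {a} {y} p with y ≡ᵇ a | ≡ᵇ-reflects-≡ y a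
... | true | ofʸ y≡a = y≡a

∪⁺ˡ : ∀ {S T y} → y ∈ S → y ∈ S ∪ T
∪⁺ˡ p rewrite p = refl

∪⁺ʳ : ∀ {S T y} → y ∈ T → y ∈ S ∪ T
∪⁺ʳ {S} {y = y} p rewrite p = ∨-zeroʳ (S y)

∪⁻ : ∀ {S T y} → y ∈ S ∪ T → y ∈ S ⊎ y ∈ T
∪⁻ {S} {y = y} p with S y
... | true = inj₁ refl
... | false = inj₂ p

∪-cong : ∀ {S S' T T'} → S ≗ S' → T ≗ T' → S ∪ T ≗ S' ∪ T'
∪-cong S≗S' T≗T' y = cong₂ _∨_ (S≗S' y) (T≗T' y)

∪-assoc : ∀ R S T → (R ∪ S) ∪ T ≗ R ∪ (S ∪ T)
∪-assoc R S T y = ∨-assoc (R y) (S y) (T y)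

∪-comm : ∀ S T → S ∪ T ≗ T ∪ S
∪-comm S T y = ∨-comm (S y) (T y)

Above⁺ : ∀ {x A a} → a ∈ A → x < a → a ∈ Above x A
Above⁺ {x} {a = a} p x<a rewrite p with x <ᵇ a | <ᵇ-reflects-< x a
... | true | _ = refl
... | false | ofⁿ x≮a = contradiction x<a x≮a

Above⁻ : ∀ {x A a} → a ∈ Above x A → a ∈ A × x < a
Above⁻ {x} {A} {a} p with A a | x <ᵇ a | <ᵇ-reflects-< x a
... | true | true | ofʸ x<a = refl , x<a

Above-⊆ : ∀ {x A} → Above x A ⊆ A
Above-⊆ {x} {A} _ p = proj₁ (Above⁻ {x} {A} p)

Above-mono : ∀ {x y A B} → x ≤ y → A ⊆ B → Above y A ⊆ Above x B
Above-mono {x} {y} {A} {B} x≤y A⊆B a p with Above⁻ {y} {A} p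
... | a∈A , y<a = Above⁺ {x} {B} (A⊆B a a∈A) (≤-<-trans x≤y y<a)

Above-nested : ∀ {x a A} → x < a → Above a A ⊆ Above a (Above x A)
Above-nested {x} {a} {A} x<a y p with Above⁻ {a} {A} p
... | y∈A , a<y = Above⁺ {a} {Above x A} (Above⁺ {x} {A} y∈A (<-trans x<a a<y)) a<y

─⁻ : ∀ {S a y} → y ∈ S ─ a → y ∈ S × y ≢ a
─⁻ {S} {a} {y} p with S y | y ≡ᵇ a | ≡ᵇ-reflects-≡ y a
... | true | false | ofⁿ y≢a = refl , y≢a

↾⁻ : ∀ {S x y} → y ∈ S ↾ x → y ∈ S × y ≤ x
↾⁻ {S} {x} {y} p with S y | y ≤ᵇ x | ≤ᵇ-reflects-≤ y x
... | true | true | ofʸ y≤x = refl , y≤x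

↾-agrees : ∀ {S x y} → y ≤ x → (S ↾ x) y ≡ S y
↾-agrees {S} {x} {y} y≤x with y ≤ᵇ x | ≤ᵇ-reflects-≤ y x
... | true | _ = ∧-identityʳ (S y)
... | false | ofⁿ y≰x = contradiction y≤x y≰x

─∪⁅⁆ : ∀ {S a} → a ∈ S → S ─ a ∪ ⁅ a ⁆ ≗ S
─∪⁅⁆ {S} {a} a∈S y with y ≡ᵇ a | ≡ᵇ-reflects-≡ y a
... | true | ofʸ refl = trans (∨-zeroʳ _) (sym a∈S)
... | false | _ = trans (∨-identityʳ _) (∧-identityʳ (S y))

─-∉ : ∀ {S a} → S a ≡ false → S ─ a ≗ S
─-∉ {S} {a} a∉S y with y ≡ᵇ a | ≡ᵇ-reflects-≡ y a
... | true | ofʸ refl = trans (∧-zeroʳ (S a)) (sym a∉S)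
... | false | _ = ∧-identityʳ (S y)

all-∉⇒≗∅ : ∀ {S} → (∀ y → ¬ y ∈ S) → S ≗ ∅
all-∉⇒≗∅ {S} y∉S y = ∉⇒false {S} (y∉S y)

⁅⁆∪Above : ∀ {a T} → IsLeast a T → ⁅ a ⁆ ∪ Above a T ≗ T
⁅⁆∪Above {a} {T} (a∈T , a-least) y with y ≡ᵇ a | ≡ᵇ-reflects-≡ y a
... | true | ofʸ refl = sym a∈T
... | false | ofⁿ y≢a with T y in y∈T
...   | false = refl
...   | true with a <ᵇ y | <ᵇ-reflects-< a y
...     | true | _ = refl
...     | false | ofⁿ a≮y = contradiction (≤∧≢⇒< (a-least y y∈T) (y≢a ∘ sym)) a≮y

Above-pointed : ∀ {c A} → Above c (⁅ c ⁆ ∪ Above c A) ≗ Above c A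
Above-pointed {c} {A} y with c <ᵇ y | <ᵇ-reflects-< c y
... | false | _ = trans (∧-zeroʳ _) (sym (∧-zeroʳ (A y)))
... | true | ofʸ c<y with y ≡ᵇ c | ≡ᵇ-reflects-≡ y c
...   | true | ofʸ refl = contradiction c<y (<-irrefl refl)
...   | false | _ = ∧-identityʳ _

least-element : ∀ {T} x → x ∈ T → ∃ λ n → IsLeast n T
least-element {T} x x∈T = search 0 x (λ _ ()) x∈T
  where
  search : ∀ k d → (∀ y → y < k → ¬ y ∈ T) → k + d ∈ T → ∃ λ n → IsLeast n T
  search k d none-below p with T k in k∈T
  search k d none-below p | true = k , k∈T , λ y y∈T → ≮⇒≥ (λ y<k → none-below y y<k y∈T)
  search k zero none-below p | false =
    contradiction (trans (sym k∈T) (subst (_∈ T) (+-identityʳ k) p)) λ ()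
  search k (suc d) none-below p | false =
    search (suc k) d none-below' (subst (_∈ T) (+-suc k d) p)
    where
    none-below' : ∀ y → y < suc k → ¬ y ∈ T
    none-below' y y<1+k with m≤n⇒m<n∨m≡n (≤-pred y<1+k)
    ... | inj₁ y<k = none-below y y<k
    ... | inj₂ refl = λ y∈T → contradiction (trans (sym k∈T) y∈T) λ ()

IsLeast-unique : ∀ {m n T} → IsLeast m T → IsLeast n T → m ≡ n
IsLeast-unique (m∈T , m-least) (n∈T , n-least) = ≤-antisym (m-least _ n∈T) (n-least _ m∈T)

Below-resp : ∀ {m S S'} → S ≗ S' → Below m S → Below m S'
Below-resp S≗S' below y y∈S' = below y (∈-resp-≗ (≗-sym S≗S') y∈S')

Below-─ : ∀ {m S} → Below (suc m) S → Below m (S ─ m)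
Below-─ {m} {S} below y p with ─⁻ {S} p
... | y∈S , y≢m = ≤∧≢⇒< (≤-pred (below y y∈S)) y≢m

Below-mono : ∀ {m n S} → m ≤ n → Below m S → Below n S
Below-mono m≤n below y y∈S = <-≤-trans (below y y∈S) m≤n

Below-∪⁅⁆ : ∀ {a S} → Below a S → Below (suc a) (S ∪ ⁅ a ⁆)
Below-∪⁅⁆ {a} {S} below y y∈ with ∪⁻ {S} {⁅ a ⁆} y∈
... | inj₁ y∈S = m<n⇒m<1+n (below y y∈S)
... | inj₂ y∈⁅a⁆ = s≤s (≤-reflexive (⁅⁆⁻ {a} {y} y∈⁅a⁆))

-- Oracle computations

χ-cong : ∀ {S S' x} → S x ≡ S' x → χ S x ≡ χ S' x
χ-cong e rewrite e = refl

χ-∈ : ∀ {C c} → c ∈ C → χ C c ≡ 1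
χ-∈ c∈C rewrite c∈C = refl

χ≡1⇒∈ : ∀ {C c} → χ C c ≡ 1 → c ∈ C
χ≡1⇒∈ {C} {c} χ≡1 with C c
... | true = refl

AgreeUpTo : ℕ → SetN → SetN → Set
AgreeUpTo m S S' = ∀ y → y ≤ m → S y ≡ S' y

HoldsNear : SetN → (SetN → Set) → Set
HoldsNear S P = ∃ λ m → ∀ S' → AgreeUpTo m S S' → P S'

near-const : ∀ {S} {P : SetN → Set} → (∀ S' → P S') → HoldsNear S P
near-const p = 0 , λ S' _ → p S'

near-map : ∀ {S} {P Q : SetN → Set} → (∀ {S'} → P S' → Q S') → HoldsNear S P → HoldsNear S Q
near-map f (m , p) = m , λ S' a → f (p S' a)

near-zip : ∀ {S} {P Q R : SetN → Set} → (∀ {S'} → P S' → Q S' → R S') →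
           HoldsNear S P → HoldsNear S Q → HoldsNear S R
near-zip f (m , p) (n , q) =
  m ⊔ n , λ S' a → f (p S' (λ y y≤ → a y (≤-trans y≤ (m≤m⊔n m n))))
                     (q S' (λ y y≤ → a y (≤-trans y≤ (m≤n⊔m m n))))

mutual
  eval-use : ∀ {S n} {e : Code n} {xs z} → Eval S e xs z → HoldsNear S (λ S' → Eval S' e xs z)
  eval-use ev-zer = near-const λ _ → ev-zer
  eval-use ev-succ = near-const λ _ → ev-succ
  eval-use (ev-proj i) = near-const λ _ → ev-proj i
  eval-use {S} (ev-oracle {x}) =
    x , λ S' a → subst (Eval S' oracle (x ∷ [])) (χ-cong {S'} {S} (sym (a x ≤-refl))) ev-oracle
  eval-use (ev-comp hs g) = near-zip ev-comp (evalVec-use hs) (eval-use g)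
  eval-use (ev-prec0 f) = near-map ev-prec0 (eval-use f)
  eval-use (ev-precS r g) = near-zip ev-precS (eval-use r) (eval-use g)
  eval-use (ev-mu {z = z} f below) = near-zip ev-mu (eval-use f) (evalBelow-use z below)

  evalVec-use : ∀ {S n m} {xs : Vec ℕ n} {hs : Vec (Code n) m} {ys} →
                EvalVec S xs hs ys → HoldsNear S (λ S' → EvalVec S' xs hs ys)
  evalVec-use evv-[] = near-const λ _ → evv-[]
  evalVec-use (evv-∷ h hs) = near-zip evv-∷ (eval-use h) (evalVec-use hs)

  evalBelow-use : ∀ {S n} {f : Code (suc n)} {xs} z →
    (∀ y → y < z → ∃ λ v → Eval S f (y ∷ xs) (suc v)) →
    HoldsNear S (λ S' → ∀ y → y < z → ∃ λ v → Eval S' f (y ∷ xs) (suc v))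
  evalBelow-use zero _ = near-const λ _ _ ()
  evalBelow-use {S} {f = f} {xs} (suc z) below =
    near-zip extend (evalBelow-use z (λ y y<z → below y (m<n⇒m<1+n y<z)))
                    (eval-use (proj₂ (below z ≤-refl)))
    where
    extend : ∀ {S'} → (∀ y → y < z → ∃ λ v → Eval S' f (y ∷ xs) (suc v)) →
             Eval S' f (z ∷ xs) (suc (proj₁ (below z ≤-refl))) →
             ∀ y → y < suc z → ∃ λ v → Eval S' f (y ∷ xs) (suc v)
    extend below' last y y<1+z with m≤n⇒m<n∨m≡n (≤-pred y<1+z)
    ... | inj₁ y<z = below' y y<z
    ... | inj₂ refl = _ , last

mutual
  eval-deterministic : ∀ {S n} {e : Code n} {xs z z'} → Eval S e xs z → Eval S e xs z' → z ≡ z'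
  eval-deterministic ev-zer ev-zer = refl
  eval-deterministic ev-succ ev-succ = refl
  eval-deterministic (ev-proj i) (ev-proj .i) = refl
  eval-deterministic ev-oracle ev-oracle = refl
  eval-deterministic (ev-comp hs g) (ev-comp hs' g')
    rewrite evalVec-deterministic hs hs' = eval-deterministic g g'
  eval-deterministic (ev-prec0 f) (ev-prec0 f') = eval-deterministic f f'
  eval-deterministic (ev-precS r g) (ev-precS r' g')
    rewrite eval-deterministic r r' = eval-deterministic g g'
  eval-deterministic (ev-mu {z = z} f below) (ev-mu {z = z'} f' below') with <-cmp z z'
  ... | tri< z<z' _ _ = contradiction (eval-deterministic f (proj₂ (below' z z<z'))) λ ()
  ... | tri≈ _ z≡z' _ = z≡z'
  ... | tri> _ _ z'<z = contradiction (eval-deterministic (proj₂ (below z' z'<z)) f') λ ()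

  evalVec-deterministic : ∀ {S n m} {xs : Vec ℕ n} {hs : Vec (Code n) m} {ys ys'} →
                          EvalVec S xs hs ys → EvalVec S xs hs ys' → ys ≡ ys'
  evalVec-deterministic evv-[] evv-[] = refl
  evalVec-deterministic (evv-∷ h hs) (evv-∷ h' hs') =
    cong₂ _∷_ (eval-deterministic h h') (evalVec-deterministic hs hs')

eval-resp : ∀ {S S' n} {e : Code n} {xs z} → S ≗ S' → Eval S e xs z → Eval S' e xs z
eval-resp S≗S' ev = proj₂ (eval-use ev) _ λ y _ → S≗S' y

-- Codes of functionals are countable

-- Decoding trees is structurally recursive, so toTree is injective by having a
-- left inverse; trees are then serialised injectively with a unary prefix code.
data Tree : Set where
  node : ℕ → List Tree → Tree

mutual
  toTree : ∀ {n} → Code n → Tree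
  toTree zer = node 0 []
  toTree succ = node 1 []
  toTree (proj i) = node 2 (node (toℕ i) [] ∷ [])
  toTree oracle = node 3 []
  toTree (comp {m} g hs) = node 4 (node m [] ∷ toTree g ∷ toTrees hs)
  toTree (prec f g) = node 5 (toTree f ∷ toTree g ∷ [])
  toTree (mu f) = node 6 (toTree f ∷ [])

  toTrees : ∀ {n m} → Vec (Code n) m → List Tree
  toTrees [] = []
  toTrees (h ∷ hs) = toTree h ∷ toTrees hs

-- The tree is the first argument so that clauses split on it before the arity,
-- which lets fromTree (toTree c) n compute for a variable n.
mutual
  fromTree : Tree → ∀ n → Maybe (Code n)
  fromTree (node 0 []) n = just zer
  fromTree (node 1 []) 1 = just succ
  fromTree (node 2 (node i [] ∷ [])) n with i <? n
  ... | yes i<n = just (proj (fromℕ< i<n))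
  ... | no _ = nothing
  fromTree (node 3 []) 1 = just oracle
  fromTree (node 4 (node m [] ∷ g ∷ hs)) n = zipWith comp (fromTree g m) (fromTrees hs n m)
  fromTree (node 5 (f ∷ g ∷ [])) (suc n) = zipWith prec (fromTree f n) (fromTree g (suc (suc n)))
  fromTree (node 6 (f ∷ [])) n = Maybe.map mu (fromTree f (suc n))
  fromTree _ _ = nothing

  fromTrees : List Tree → ∀ n m → Maybe (Vec (Code n) m)
  fromTrees [] n zero = just []
  fromTrees (t ∷ ts) n (suc m) = zipWith _∷_ (fromTree t n) (fromTrees ts n m)
  fromTrees _ _ _ = nothing

mutual
  fromTree-toTree : ∀ {n} (c : Code n) → fromTree (toTree c) n ≡ just c
  fromTree-toTree zer = refl
  fromTree-toTree succ = refl
  fromTree-toTree {n} (proj i) with toℕ i <? n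
  ... | yes i<n = cong (just ∘ proj) (fromℕ<-toℕ i i<n)
  ... | no i≮n = contradiction (toℕ<n i) i≮n
  fromTree-toTree oracle = refl
  fromTree-toTree (comp g hs) rewrite fromTree-toTree g | fromTrees-toTrees hs = refl
  fromTree-toTree (prec f g) rewrite fromTree-toTree f | fromTree-toTree g = refl
  fromTree-toTree (mu f) rewrite fromTree-toTree f = refl

  fromTrees-toTrees : ∀ {n m} (hs : Vec (Code n) m) → fromTrees (toTrees hs) n m ≡ just hs
  fromTrees-toTrees [] = refl
  fromTrees-toTrees (h ∷ hs) rewrite fromTree-toTree h | fromTrees-toTrees hs = refl

toTree-injective : ∀ {n} {c c' : Code n} → toTree c ≡ toTree c' → c ≡ c'
toTree-injective {n} {c} {c'} eq = just-injective (begin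
  just c                 ≡⟨ sym (fromTree-toTree c) ⟩
  fromTree (toTree c) n  ≡⟨ cong (λ t → fromTree t n) eq ⟩
  fromTree (toTree c') n ≡⟨ fromTree-toTree c' ⟩
  just c'                ∎)
  where open ≡-Reasoning

unary : ℕ → ℕᵇ → ℕᵇ
unary zero r = 1+[2 r ]
unary (suc a) r = 2[1+ unary a r ]

unary-injective : ∀ a a' {r r'} → unary a r ≡ unary a' r' → a ≡ a' × r ≡ r'
unary-injective zero zero refl = refl , refl
unary-injective (suc a) (suc a') eq with unary-injective a a' (ℕᵇ.2[1+_]-injective eq)
... | refl , r≡r' = refl , r≡r'

mutual
  serialise : Tree → ℕᵇ → ℕᵇ
  serialise (node t ts) r = unary t (unary (length ts) (serialiseAll ts r))

  serialiseAll : List Tree → ℕᵇ → ℕᵇ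
  serialiseAll [] r = r
  serialiseAll (t ∷ ts) r = serialise t (serialiseAll ts r)

mutual
  serialise-injective : ∀ t t' {r r'} → serialise t r ≡ serialise t' r' → t ≡ t' × r ≡ r'
  serialise-injective (node t ts) (node t' ts') eq with unary-injective t t' eq
  ... | refl , eq₁ with unary-injective (length ts) (length ts') eq₁
  ... | |ts|≡|ts'| , eq₂ with serialiseAll-injective ts ts' |ts|≡|ts'| eq₂
  ... | refl , r≡r' = refl , r≡r'

  serialiseAll-injective : ∀ ts ts' {r r'} → length ts ≡ length ts' →
                           serialiseAll ts r ≡ serialiseAll ts' r' → ts ≡ ts' × r ≡ r'
  serialiseAll-injective [] [] _ eq = refl , eq
  serialiseAll-injective (t ∷ ts) (t' ∷ ts') |ts|≡|ts'| eq with serialise-injective t t' eq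
  ... | refl , eq₁ with serialiseAll-injective ts ts' (suc-injective |ts|≡|ts'|) eq₁
  ... | refl , r≡r' = refl , r≡r'

⌜_⌝ : Code 1 → ℕ
⌜ Φ ⌝ = ℕᵇ.toℕ (serialise (toTree Φ) ℕᵇ.zero)

⌜⌝-injective : ∀ {Φ Ψ} → ⌜ Φ ⌝ ≡ ⌜ Ψ ⌝ → Φ ≡ Ψ
⌜⌝-injective {Φ} {Ψ} eq =
  toTree-injective (proj₁ (serialise-injective (toTree Φ) (toTree Ψ) (ℕᵇ.toℕ-injective eq)))

-- Infinite sets and thinning

Infinite-mono : ∀ {S T} → S ⊆ T → Infinite S → Infinite T
Infinite-mono S⊆T inf n with inf n
... | m , n≤m , m∈S = m , n≤m , S⊆T m m∈S

Above-infinite : ∀ {A} x → Infinite A → Infinite (Above x A)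
Above-infinite {A} x inf n with inf (n + suc x)
... | m , n+1+x≤m , m∈A = m , ≤-trans (m≤m+n n (suc x)) n+1+x≤m ,
                          Above⁺ {x} {A} m∈A (≤-trans (m≤n+m (suc x) n) n+1+x≤m)

Hereditary : (SetN → Set) → Set
Hereditary P = ∀ {A A'} → P A → A' ⊆ A → P A'

Thinning : (SetN → Set) → SetN → Set
Thinning P A = ∃ λ A' → A' ⊆ A × Infinite A' × P A'

Thinning-map : ∀ {P Q A B} → A ⊆ B → (∀ {A'} → P A' → Q A') → Thinning P A → Thinning Q B
Thinning-map A⊆B f (A' , A'⊆A , inf' , p) = A' , ⊆-trans A'⊆A A⊆B , inf' , f p

Dense : (SetN → Set) → Set
Dense P = ∀ A → Infinite A → Thinning P A

Dense-map : ∀ {P Q} → (∀ {A} → P A → Q A) → Dense P → Dense Q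
Dense-map f P-dense A inf = Thinning-map ⊆-refl f (P-dense A inf)

dense-× : ∀ {P Q} → Hereditary P → Dense P → Dense Q → Dense (λ A → P A × Q A)
dense-× P-her P-dense Q-dense A inf with P-dense A inf
... | A₁ , A₁⊆A , inf₁ , p with Q-dense A₁ inf₁
... | A₂ , A₂⊆A₁ , inf₂ , q = A₂ , ⊆-trans A₂⊆A₁ A₁⊆A , inf₂ , P-her p A₂⊆A₁ , q

StrictlyIncreasing : (ℕ → ℕ) → Set
StrictlyIncreasing h = ∀ k → h k < h (suc k)

module Increasing {h : ℕ → ℕ} (inc : StrictlyIncreasing h) where

  mono-< : ∀ {j k} → j < k → h j < h k
  mono-< {j} {suc k} j<1+k with m≤n⇒m<n∨m≡n (≤-pred j<1+k)
  ... | inj₁ j<k = <-trans (mono-< j<k) (inc k)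
  ... | inj₂ refl = inc k

  mono-≤ : ∀ {j k} → j ≤ k → h j ≤ h k
  mono-≤ j≤k with m≤n⇒m<n∨m≡n j≤k
  ... | inj₁ j<k = <⇒≤ (mono-< j<k)
  ... | inj₂ refl = ≤-refl

  cancel-< : ∀ {j k} → h j < h k → j < k
  cancel-< hj<hk = ≰⇒> λ k≤j → <⇒≱ hj<hk (mono-≤ k≤j)

  cancel-≤ : ∀ {j k} → h j ≤ h k → j ≤ k
  cancel-≤ hj≤hk = ≮⇒≥ λ k<j → <⇒≱ (mono-< k<j) hj≤hk

  injective : ∀ {j k} → h j ≡ h k → j ≡ k
  injective hj≡hk = ≤-antisym (cancel-≤ (≤-reflexive hj≡hk)) (cancel-≤ (≤-reflexive (sym hj≡hk)))

  inflationary : ∀ k → k ≤ h k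
  inflationary zero = z≤n
  inflationary (suc k) = <-≤-trans (s≤s (inflationary k)) (inc k)


module _ {D : SetN → SetN → Set}
         (D-her : ∀ s → Hereditary (D s))
         (D-resp : ∀ {s s' A} → s ≗ s' → D s A → D s' A)
         (D-dense : ∀ s → Dense (D s)) where

  AllStems : ℕ → SetN → SetN → Set
  AllStems m b A = ∀ s → Below m s → D (b ∪ s) A

  stems-dense : ∀ m b → Dense (AllStems m b)
  stems-dense zero b = Dense-map (λ d s below → D-resp (b≗b∪s below) d) (D-dense b)
    where
    b≗b∪s : ∀ {s} → Below 0 s → b ≗ b ∪ s
    b≗b∪s {s} below y rewrite all-∉⇒≗∅ {s} (λ y y∈s → n≮0 (below y y∈s)) y =
      sym (∨-identityʳ (b y))
  stems-dense (suc m) b =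
    Dense-map combine (dense-× her (stems-dense m (b ∪ ⁅ m ⁆)) (stems-dense m b))
    where
    her : ∀ {c} → Hereditary (AllStems m c)
    her all A'⊆A s below = D-her _ (all s below) A'⊆A
    combine : ∀ {A} → AllStems m (b ∪ ⁅ m ⁆) A × AllStems m b A → AllStems (suc m) b A
    combine (with-m , without-m) s below with s m in m∈s
    ... | true = D-resp regroup (with-m (s ─ m) (Below-─ below))
      where
      regroup : (b ∪ ⁅ m ⁆) ∪ (s ─ m) ≗ b ∪ s
      regroup = ≗-trans (∪-assoc b ⁅ m ⁆ (s ─ m))
                        (∪-cong (λ _ → refl) (≗-trans (∪-comm ⁅ m ⁆ (s ─ m)) (─∪⁅⁆ m∈s)))
    ... | false = without-m s (Below-resp (─-∉ m∈s) (Below-─ below))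

-- Fusion and the Nash-Williams theorem

Open : (SetN → Set) → Set
Open U = ∀ T → Infinite T → U T → HoldsNear T U

Homogeneous : (SetN → Set) → SetN → Set
Homogeneous U H = (∀ T → Infinite T → T ⊆ H → U T) ⊎ (∀ T → Infinite T → T ⊆ H → ¬ U T)

Homogeneous-her : ∀ {U} → Hereditary (Homogeneous U)
Homogeneous-her (inj₁ all) A'⊆A = inj₁ λ T inf T⊆A' → all T inf (⊆-trans T⊆A' A'⊆A)
Homogeneous-her (inj₂ none) A'⊆A = inj₂ λ T inf T⊆A' → none T inf (⊆-trans T⊆A' A'⊆A)

module WithExcludedMiddle (em : ExcludedMiddle 0ℓ) where

  toSet : (ℕ → Set) → SetN
  toSet P x = does (em {P x})

  toSet⁺ : ∀ {P x} → P x → x ∈ toSet P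
  toSet⁺ {P} {x} p with em {P x}
  ... | yes _ = refl
  ... | no ¬p = contradiction p ¬p

  toSet⁻ : ∀ {P x} → x ∈ toSet P → P x
  toSet⁻ {P} {x} q with em {P x}
  ... | yes p = p

  image : (ℕ → ℕ) → SetN
  image h = toSet λ y → ∃ λ k → h k ≡ y

  image⁺ : ∀ {h} k → h k ∈ image h
  image⁺ {h} k = toSet⁺ {λ y → ∃ λ j → h j ≡ y} (k , refl)

  image⁻ : ∀ {h y} → y ∈ image h → ∃ λ k → h k ≡ y
  image⁻ {h} = toSet⁻ {λ y → ∃ λ k → h k ≡ y}

  image-⊆ : ∀ {h A} → (∀ k → h k ∈ A) → image h ⊆ A
  image-⊆ h∈A y y∈image with image⁻ y∈image
  ... | k , refl = h∈A k

  image-infinite : ∀ {h} → StrictlyIncreasing h → Infinite (image h)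
  image-infinite inc n = _ , Increasing.inflationary inc n , image⁺ n

  image-tail : ∀ {h} → StrictlyIncreasing h → ∀ i y → y ∈ image h → h (suc i) ≤ y →
               y ∈ Above (h i) (image h)
  image-tail {h} inc i y y∈image h[1+i]≤y with image⁻ y∈image
  ... | k , refl = Above⁺ {h i} {image h} y∈image (Increasing.mono-< inc (Increasing.cancel-≤ inc h[1+i]≤y))

  Fused : (ℕ → SetN → Set) → SetN → (ℕ → ℕ) → Set
  Fused Q A h = StrictlyIncreasing h × (∀ k → h k ∈ A) × (∀ k → Q (h k) (Above (h k) (image h)))

  module _ {Q : ℕ → SetN → Set} (Q-her : ∀ x → Hereditary (Q x)) (Q-dense : ∀ x → Dense (Q x)) where

    private
      InfiniteSet : Set
      InfiniteSet = Σ SetN Infinite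

      element : InfiniteSet → ℕ
      element (_ , inf) = proj₁ (inf 0)

      element∈ : ∀ S → element S ∈ proj₁ S
      element∈ (_ , inf) = proj₂ (proj₂ (inf 0))

      shrink : (S : InfiniteSet) → Thinning (Q (element S)) (Above (element S) (proj₁ S))
      shrink S@(A , inf) = Q-dense (element S) (Above (element S) A) (Above-infinite (element S) inf)

      module Fusion (A : SetN) (inf : Infinite A) where

        stage : ℕ → InfiniteSet
        stage zero = A , inf
        stage (suc k) = proj₁ (shrink (stage k)) , proj₁ (proj₂ (proj₂ (shrink (stage k))))

        h : ℕ → ℕ
        h k = element (stage k)

        stage-step : ∀ k → proj₁ (stage (suc k)) ⊆ Above (h k) (proj₁ (stage k))
        stage-step k = proj₁ (proj₂ (shrink (stage k)))

        h-increasing : StrictlyIncreasing h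
        h-increasing k = proj₂ (Above⁻ {h k} {proj₁ (stage k)} (stage-step k _ (element∈ (stage (suc k)))))

        stage-⊆ : ∀ {j k} → j ≤ k → proj₁ (stage k) ⊆ proj₁ (stage j)
        stage-⊆ {k = zero} z≤n = ⊆-refl
        stage-⊆ {k = suc k} j≤1+k with m≤n⇒m<n∨m≡n j≤1+k
        ... | inj₁ j<1+k = ⊆-trans (⊆-trans (stage-step k) Above-⊆) (stage-⊆ (≤-pred j<1+k))
        ... | inj₂ refl = ⊆-refl

        h∈stage : ∀ {j k} → j ≤ k → h k ∈ proj₁ (stage j)
        h∈stage {k = k} j≤k = stage-⊆ j≤k _ (element∈ (stage k))

        tail-⊆ : ∀ k → Above (h k) (image h) ⊆ proj₁ (stage (suc k))
        tail-⊆ k y p with Above⁻ {h k} {image h} p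
        ... | y∈image , h[k]<y with image⁻ y∈image
        ...   | j , refl = h∈stage {suc k} {j} (Increasing.cancel-< h-increasing h[k]<y)

    fusion : ∀ A → Infinite A → ∃ (Fused Q A)
    fusion A inf = h , h-increasing , (λ k → h∈stage {0} {k} z≤n) ,
                   (λ k → Q-her (h k) (proj₂ (proj₂ (proj₂ (shrink (stage k))))) (tail-⊆ k))
      where open Fusion A inf

  dne : ∀ {P : Set} → ¬ ¬ P → P
  dne = em⇒dne em

  module NashWilliams {U : SetN → Set} (U-open : Open U) where

    U-resp : ∀ {T T'} → Infinite T → T ≗ T' → U T → U T'
    U-resp inf T≗T' u with U-open _ inf u
    ... | _ , near = near _ λ y _ → T≗T' y

    -- Acceptance and rejection in the sense of Galvin and Prikry.
    Accepts : SetN → SetN → Set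
    Accepts s A = ∀ T → Infinite T → T ⊆ A → U (s ∪ T)

    Rejects : SetN → SetN → Set
    Rejects s A = ∀ A' → Infinite A' → A' ⊆ A → ¬ Accepts s A'

    Decides : SetN → SetN → Set
    Decides s A = Accepts s A ⊎ Rejects s A

    Accepts-her : ∀ s → Hereditary (Accepts s)
    Accepts-her _ acc A'⊆A T inf T⊆A' = acc T inf (⊆-trans T⊆A' A'⊆A)

    Rejects-her : ∀ s → Hereditary (Rejects s)
    Rejects-her _ rej A'⊆A A'' inf A''⊆A' = rej A'' inf (⊆-trans A''⊆A' A'⊆A)

    Decides-her : ∀ s → Hereditary (Decides s)
    Decides-her s (inj₁ acc) A'⊆A = inj₁ (Accepts-her s acc A'⊆A)
    Decides-her s (inj₂ rej) A'⊆A = inj₂ (Rejects-her s rej A'⊆A)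

    Accepts-resp : ∀ {s s' A} → s ≗ s' → Accepts s A → Accepts s' A
    Accepts-resp {s} s≗s' acc T inf T⊆A =
      U-resp (Infinite-mono {T} {s ∪ T} (λ _ → ∪⁺ʳ {s} {T}) inf) (∪-cong s≗s' λ _ → refl)
             (acc T inf T⊆A)

    Rejects-resp : ∀ {s s' A} → s ≗ s' → Rejects s A → Rejects s' A
    Rejects-resp s≗s' rej A' inf A'⊆A acc = rej A' inf A'⊆A (Accepts-resp (≗-sym s≗s') acc)

    Decides-resp : ∀ {s s' A} → s ≗ s' → Decides s A → Decides s' A
    Decides-resp s≗s' (inj₁ acc) = inj₁ (Accepts-resp s≗s' acc)
    Decides-resp s≗s' (inj₂ rej) = inj₂ (Rejects-resp s≗s' rej)

    Rejects-by-cases : ∀ {s x A} → Rejects (s ─ x) A → (x ∈ s → Rejects (s ─ x ∪ ⁅ x ⁆) A) →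
                       Rejects s A
    Rejects-by-cases {s} {x} without-x with-x with s x in x∈s
    ... | true = Rejects-resp (─∪⁅⁆ x∈s) (with-x refl)
    ... | false = Rejects-resp (─-∉ x∈s) without-x

    decides-dense : ∀ s → Dense (Decides s)
    decides-dense s A inf with em {Thinning (Accepts s) A}
    ... | yes (A' , A'⊆A , inf' , acc) = A' , A'⊆A , inf' , inj₁ acc
    ... | no none = A , ⊆-refl , inf , inj₂ λ A' inf' A'⊆A acc → none (A' , A'⊆A , inf' , acc)

    DecidesBelow : ℕ → SetN → Set
    DecidesBelow x A = ∀ s → Below (suc x) s → Decides s A

    decidesBelow-dense : ∀ x → Dense (DecidesBelow x)
    decidesBelow-dense x = stems-dense Decides-her Decides-resp decides-dense (suc x) ∅

    -- Otherwise the a whose extension is accepted form an infinite set accepting s.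
    rejects-almost-all : ∀ {s A} → Rejects s A → (∀ a → a ∈ A → Decides (s ∪ ⁅ a ⁆) (Above a A)) →
                         ∃ λ N → ∀ a → a ∈ A → N < a → Rejects (s ∪ ⁅ a ⁆) (Above a A)
    rejects-almost-all {s} {A} rej decides = dne λ no-bound → rej G (G-infinite no-bound) G⊆A G-accepts
      where
      Good : ℕ → Set
      Good a = a ∈ A × Accepts (s ∪ ⁅ a ⁆) (Above a A)

      G : SetN
      G = toSet Good

      G⊆A : G ⊆ A
      G⊆A a a∈G = proj₁ (toSet⁻ {Good} a∈G)

      G-infinite : ¬ (∃ λ N → ∀ a → a ∈ A → N < a → Rejects (s ∪ ⁅ a ⁆) (Above a A)) → Infinite G
      G-infinite no-bound n = dne λ none-above → no-bound (n , λ a a∈A n<a → rejects a a∈A λ acc →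
                                none-above (a , <⇒≤ n<a , toSet⁺ {Good} (a∈A , acc)))
        where
        rejects : ∀ a → a ∈ A → ¬ Accepts (s ∪ ⁅ a ⁆) (Above a A) → Rejects (s ∪ ⁅ a ⁆) (Above a A)
        rejects a a∈A ¬acc with decides a a∈A
        ... | inj₁ acc = contradiction acc ¬acc
        ... | inj₂ rej = rej

      G-accepts : Accepts s G
      G-accepts T inf T⊆G with least-element (proj₁ (inf 0)) (proj₂ (proj₂ (inf 0)))
      ... | a , a-least@(a∈T , _) =
        U-resp (Infinite-mono {Above a T} (λ _ → ∪⁺ʳ {s ∪ ⁅ a ⁆} {Above a T}) tail-infinite) regroup
               (proj₂ (toSet⁻ {Good} (T⊆G a a∈T)) (Above a T) tail-infinite
                      (Above-mono {a} {a} {T} {A} ≤-refl (⊆-trans {T} {G} {A} T⊆G G⊆A)))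
        where
        tail-infinite : Infinite (Above a T)
        tail-infinite = Above-infinite {T} a inf

        regroup : (s ∪ ⁅ a ⁆) ∪ Above a T ≗ s ∪ T
        regroup = ≗-trans (∪-assoc s ⁅ a ⁆ (Above a T)) (∪-cong (λ _ → refl) (⁅⁆∪Above a-least))

    -- Once H rejects ∅, fuse it so that every finite subset of the fused sequence
    -- is rejected; openness of U then excludes every infinite subset.
    module Rejecting {H : SetN} (H-infinite : Infinite H)
                     (H-decides : ∀ x → x ∈ H → DecidesBelow x (Above x H)) (rej : Rejects ∅ H) where

      singletons : ∃ λ N → ∀ a → a ∈ H → N < a → Rejects ⁅ a ⁆ (Above a H)
      singletons =
        rejects-almost-all rej λ a a∈H → H-decides a a∈H ⁅ a ⁆ (Below-∪⁅⁆ {S = ∅} λ _ ())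

      N₀ : ℕ
      N₀ = proj₁ singletons

      PropagatesAt : ℕ → SetN → SetN → Set
      PropagatesAt x s A = Below (suc x) s → Rejects s (Above x H) →
                           ∀ a → a ∈ A → a ∈ H → x < a → Rejects (s ∪ ⁅ a ⁆) (Above a H)

      Propagates : ℕ → SetN → Set
      Propagates x A = ∀ s → PropagatesAt x s A

      propagates-dense : ∀ x → Dense (Propagates x)
      propagates-dense x = Dense-map (λ all s below → all s below below)
                                     (stems-dense PropagatesAt-her PropagatesAt-resp PropagatesAt-dense (suc x) ∅)
        where
        PropagatesAt-her : ∀ s → Hereditary (PropagatesAt x s)
        PropagatesAt-her s p A'⊆A below r a a∈A' = p below r a (A'⊆A a a∈A')
        PropagatesAt-resp : ∀ {s s' A} → s ≗ s' → PropagatesAt x s A → PropagatesAt x s' A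
        PropagatesAt-resp s≗s' p below r a a∈A a∈H x<a =
          Rejects-resp (∪-cong s≗s' λ _ → refl)
            (p (Below-resp (≗-sym s≗s') below) (Rejects-resp (≗-sym s≗s') r) a a∈A a∈H x<a)
        PropagatesAt-dense : ∀ s → Dense (PropagatesAt x s)
        PropagatesAt-dense s A inf with em {Below (suc x) s × Rejects s (Above x H)}
        ... | no ¬hyp = A , ⊆-refl , inf , λ below r → contradiction (below , r) ¬hyp
        ... | yes (below , r) with rejects-almost-all r decides
          where
          decides : ∀ a → a ∈ Above x H → Decides (s ∪ ⁅ a ⁆) (Above a (Above x H))
          decides a a∈ with Above⁻ {x} {H} a∈
          ... | a∈H , x<a = Decides-her _ (H-decides a a∈H (s ∪ ⁅ a ⁆) (Below-∪⁅⁆ (Below-mono x<a below)))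
                                           (Above-mono {A = Above x H} ≤-refl (Above-⊆ {x}))
        ... | N , bound = Above N A , Above-⊆ {N} , Above-infinite N inf , λ _ _ a a∈A a∈H x<a →
          Rejects-her _ (bound a (Above⁺ {x} {H} a∈H x<a) (proj₂ (Above⁻ {N} {A} a∈A)))
                        (Above-nested {x} {a} {H} x<a)

      Propagates-her : ∀ x → Hereditary (Propagates x)
      Propagates-her x p A'⊆A s below r a a∈A' = p s below r a (A'⊆A a a∈A')

      module _ {g : ℕ → ℕ} (g-increasing : StrictlyIncreasing g) (g∈ : ∀ k → g k ∈ Above N₀ H)
               (g-propagates : ∀ k → Propagates (g k) (Above (g k) (image g))) where

        open Increasing g-increasing

        image⊆H : image g ⊆ H
        image⊆H = image-⊆ λ k → Above-⊆ {N₀} {H} _ (g∈ k)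

        earlier : ∀ {s k y} → s ⊆ image g → Below (suc (g k)) s → y ∈ s ─ g k →
                  ∃ λ j → j < k × g j ≡ y
        earlier {s} {k} {y} s⊆ below y∈ with ─⁻ {s} y∈
        ... | y∈s , y≢g[k] with image⁻ (s⊆ y y∈s)
        ...   | j , refl = j , ≤∧≢⇒< (cancel-≤ (≤-pred (below _ y∈s))) (y≢g[k] ∘ cong g) , refl

        rejects-below : ∀ k s → s ⊆ image g → Below (suc (g k)) s → Rejects s (Above (g k) H)
        rejects-below zero s s⊆ below = Rejects-by-cases absent present
          where
          nothing-earlier : s ─ g 0 ≗ ∅
          nothing-earlier =
            all-∉⇒≗∅ {s ─ g 0} λ y y∈ → n≮0 (proj₁ (proj₂ (earlier {s} {0} s⊆ below y∈)))
          absent : Rejects (s ─ g 0) (Above (g 0) H)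
          absent = Rejects-resp (≗-sym nothing-earlier) (Rejects-her ∅ rej (Above-⊆ {g 0}))
          present : g 0 ∈ s → Rejects (s ─ g 0 ∪ ⁅ g 0 ⁆) (Above (g 0) H)
          present _ with Above⁻ {N₀} {H} (g∈ 0)
          ... | g[0]∈H , N₀<g[0] = Rejects-resp (∪-cong (≗-sym nothing-earlier) λ _ → refl)
                                                (proj₂ singletons (g 0) g[0]∈H N₀<g[0])
        rejects-below (suc k) s s⊆ below = Rejects-by-cases absent present
          where
          s' : SetN
          s' = s ─ g (suc k)
          below' : Below (suc (g k)) s'
          below' y y∈ with earlier {s} {suc k} s⊆ below y∈
          ... | j , j<1+k , refl = s≤s (mono-≤ (≤-pred j<1+k))
          previous : Rejects s' (Above (g k) H)
          previous = rejects-below k s' (⊆-trans (λ y y∈ → proj₁ (─⁻ {s} y∈)) s⊆) below'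
          absent : Rejects s' (Above (g (suc k)) H)
          absent = Rejects-her s' previous (Above-mono (<⇒≤ (g-increasing k)) ⊆-refl)
          present : g (suc k) ∈ s → Rejects (s' ∪ ⁅ g (suc k) ⁆) (Above (g (suc k)) H)
          present _ = g-propagates k s' below' previous (g (suc k))
                        (Above⁺ {g k} {image g} (image⁺ (suc k)) (g-increasing k))
                        (image⊆H _ (image⁺ (suc k))) (g-increasing k)

        image-avoids : ∀ T → Infinite T → T ⊆ image g → ¬ U T
        image-avoids T inf T⊆ u with U-open T inf u
        ... | m , near with inf m
        ...   | x , m≤x , x∈T with image⁻ (T⊆ x x∈T)
        ...     | k , refl = rejects-below k (T ↾ g k) (⊆-trans (λ y y∈ → proj₁ (↾⁻ {T} y∈)) T⊆)
                               (λ y y∈ → s≤s (proj₂ (↾⁻ {T} y∈)))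
                               (Above (g k) (image g)) (Above-infinite (g k) (image-infinite g-increasing))
                               (Above-mono ≤-refl image⊆H) accepts
          where
          accepts : Accepts (T ↾ g k) (Above (g k) (image g))
          accepts T' _ T'⊆ = near ((T ↾ g k) ∪ T') agree
            where
            agree : AgreeUpTo m T ((T ↾ g k) ∪ T')
            agree y y≤m = trans (sym (∨-identityʳ (T y)))
                                (cong₂ _∨_ (sym (↾-agrees {T} y≤x)) (sym (∉⇒false {T'} y∉T')))
              where
              y≤x = ≤-trans y≤m m≤x
              y∉T' : ¬ y ∈ T'
              y∉T' y∈T' = <⇒≱ (proj₂ (Above⁻ {g k} {image g} (T'⊆ y y∈T'))) y≤x

      avoiding : Thinning (λ H' → ∀ T → Infinite T → T ⊆ H' → ¬ U T) H
      avoiding = avoided (fusion Propagates-her propagates-dense (Above N₀ H) (Above-infinite N₀ H-infinite))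
        where
        avoided : ∃ (Fused Propagates (Above N₀ H)) →
                  Thinning (λ H' → ∀ T → Infinite T → T ⊆ H' → ¬ U T) H
        avoided (g , g-increasing , g∈ , g-propagates) =
          image g , image⊆H g-increasing g∈ g-propagates , image-infinite g-increasing ,
          image-avoids g-increasing g∈ g-propagates

    DecidesBelow-her : ∀ x → Hereditary (DecidesBelow x)
    DecidesBelow-her x d A'⊆A s below = Decides-her s (d s below) A'⊆A

    nash-williams : Dense (Homogeneous U)
    nash-williams A inf = decided (decides-dense ∅ A inf)
      where
      decided : Thinning (Decides ∅) A → Thinning (Homogeneous U) A
      decided (A₀ , A₀⊆A , inf₀ , decides-∅) =
        fused (fusion DecidesBelow-her decidesBelow-dense A₀ inf₀)
        where
        fused : ∃ (Fused DecidesBelow A₀) → Thinning (Homogeneous U) A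
        fused (h , h-increasing , h∈A₀ , h-decides) = conclude (Decides-her ∅ decides-∅ (image-⊆ h∈A₀))
          where
          H⊆A : image h ⊆ A
          H⊆A = ⊆-trans (image-⊆ h∈A₀) A₀⊆A
          H-decides : ∀ x → x ∈ image h → DecidesBelow x (Above x (image h))
          H-decides x x∈ with image⁻ x∈
          ... | k , refl = h-decides k
          conclude : Decides ∅ (image h) → Thinning (Homogeneous U) A
          conclude (inj₁ acc) = image h , H⊆A , image-infinite h-increasing , inj₁ acc
          conclude (inj₂ rej) =
            Thinning-map H⊆A inj₂ (Rejecting.avoiding (image-infinite h-increasing) H-decides rej)

-- The diagonal argument

-- The oracle omits n, so for {c} ∪ (D above c) it is exactly D above c.
Positive : Code 1 → SetN → Set
Positive Φ T = ∃ λ n → IsLeast n T × Eval (Above n T) Φ (n ∷ []) 1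

Positive-open : ∀ Φ → Open (Positive Φ)
Positive-open Φ T _ (n , (n∈T , n-least) , ev) with eval-use ev
... | m , near = m ⊔ n , λ S agree →
  n , (trans (sym (agree n (m≤n⊔m m n))) n∈T , n-least′ S agree) ,
  near (Above n S) λ y y≤m → cong (_∧ (n <ᵇ y)) (agree y (≤-trans y≤m (m≤m⊔n m n)))
  where
  n-least′ : ∀ S → AgreeUpTo (m ⊔ n) T S → ∀ y → y ∈ S → n ≤ y
  n-least′ S agree y y∈S =
    ≮⇒≥ λ y<n → <⇒≱ y<n (n-least y (trans (agree y (≤-trans (<⇒≤ y<n) (m≤n⊔m m n))) y∈S))

module PointedTails {Φ C D} (uniform : ∀ S → Infinite S → S ⊆ D → Computes Φ S C)
                    (D-infinite : Infinite D) where

  pointedTail : ℕ → SetN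
  pointedTail c = ⁅ c ⁆ ∪ Above c D

  pointedTail-infinite : ∀ c → Infinite (pointedTail c)
  pointedTail-infinite c =
    Infinite-mono {Above c D} (λ _ → ∪⁺ʳ {⁅ c ⁆} {Above c D}) (Above-infinite c D-infinite)

  pointedTail-least : ∀ c → IsLeast c (pointedTail c)
  pointedTail-least c = ∪⁺ˡ {⁅ c ⁆} {Above c D} {c} (⁅⁆⁺ {c}) , c≤
    where
    c≤ : ∀ y → y ∈ pointedTail c → c ≤ y
    c≤ y y∈ with ∪⁻ {⁅ c ⁆} {Above c D} y∈
    ... | inj₁ y∈⁅c⁆ = ≤-reflexive (sym (⁅⁆⁻ {c} {y} y∈⁅c⁆))
    ... | inj₂ y∈Above = <⇒≤ (proj₂ (Above⁻ {c} {D} y∈Above))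

  computes-at : ∀ c → Eval (Above c (pointedTail c)) Φ (c ∷ []) (χ C c)
  computes-at c = eval-resp (≗-sym (Above-pointed {c} {D}))
                    (uniform (Above c D) (Above-infinite c D-infinite) (Above-⊆ {c} {D}) c)

  ∈⇒Positive : ∀ {c} → c ∈ C → Positive Φ (pointedTail c)
  ∈⇒Positive {c} c∈C = c , pointedTail-least c , subst (Eval _ Φ (c ∷ [])) (χ-∈ {C} c∈C) (computes-at c)

  Positive⇒∈ : ∀ {c} → Positive Φ (pointedTail c) → c ∈ C
  Positive⇒∈ {c} (n , n-least , ev) with IsLeast-unique n-least (pointedTail-least c)
  ... | refl = χ≡1⇒∈ {C} (eval-deterministic (computes-at c) ev)

  not-homogeneous : ∀ {R} c₀ c₁ → Homogeneous (Positive Φ) R → ¬ c₀ ∈ C → c₁ ∈ C →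
                    pointedTail c₀ ⊆ R → pointedTail c₁ ⊆ R → ⊥
  not-homogeneous c₀ c₁ (inj₁ all) c₀∉C _ p₀⊆R _ =
    c₀∉C (Positive⇒∈ {c₀} (all (pointedTail c₀) (pointedTail-infinite c₀) p₀⊆R))
  not-homogeneous c₀ c₁ (inj₂ none) _ c₁∈C _ p₁⊆R =
    none (pointedTail c₁) (pointedTail-infinite c₁) p₁⊆R (∈⇒Positive {c₁} c₁∈C)

module Diagonal (em : ExcludedMiddle 0ℓ) where
  open WithExcludedMiddle em

  HomogeneousBelow : ℕ → SetN → Set
  HomogeneousBelow x A = ∀ Φ → ⌜ Φ ⌝ < x → Homogeneous (Positive Φ) A

  HomogeneousBelow-her : ∀ x → Hereditary (HomogeneousBelow x)
  HomogeneousBelow-her x hom A'⊆A Φ ⌜Φ⌝<x = Homogeneous-her (hom Φ ⌜Φ⌝<x) A'⊆A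

  homogeneousBelow-dense : ∀ x → Dense (HomogeneousBelow x)
  homogeneousBelow-dense zero A inf = A , ⊆-refl , inf , λ _ ()
  homogeneousBelow-dense (suc x) with em {∃ λ Φ → ⌜ Φ ⌝ ≡ x}
  ... | no no-code =
    Dense-map (λ hom Φ ⌜Φ⌝<1+x → hom Φ (≤∧≢⇒< (≤-pred ⌜Φ⌝<1+x) λ eq → no-code (Φ , eq)))
              (homogeneousBelow-dense x)
  ... | yes (Φ₀ , refl) =
    Dense-map extend (dense-× (HomogeneousBelow-her x) (homogeneousBelow-dense x)
                              (NashWilliams.nash-williams (Positive-open Φ₀)))
    where
    extend : ∀ {A} → HomogeneousBelow ⌜ Φ₀ ⌝ A × Homogeneous (Positive Φ₀) A →
             HomogeneousBelow (suc ⌜ Φ₀ ⌝) A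
    extend (hom , hom₀) Φ ⌜Φ⌝<1+x with m≤n⇒m<n∨m≡n (≤-pred ⌜Φ⌝<1+x)
    ... | inj₁ ⌜Φ⌝<x = hom Φ ⌜Φ⌝<x
    ... | inj₂ eq with ⌜⌝-injective {Φ} {Φ₀} eq
    ...   | refl = hom₀

  module Thinned {h : ℕ → ℕ} (h-increasing : StrictlyIncreasing h)
           (h-homogeneous : ∀ k → HomogeneousBelow (suc (h k)) (Above (h k) (image h))) where

    open Increasing h-increasing

    evens : ℕ → ℕ
    evens k = h (2 * k)

    evens-increasing : StrictlyIncreasing evens
    evens-increasing k = mono-< (*-monoʳ-< 2 (n<1+n k))

    evens⊆image : image evens ⊆ image h
    evens⊆image = image-⊆ λ k → image⁺ (2 * k)

    gap∉evens : ∀ e → ¬ h (suc (2 * e)) ∈ image evens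
    gap∉evens e gap∈evens with image⁻ {evens} gap∈evens
    ... | k , h[2k]≡gap = even≢odd k e (injective h[2k]≡gap)

    pointedTail⊆tail : ∀ {D} i c → D ⊆ image h → c ∈ image h → h (suc i) ≤ c →
                       (⁅ c ⁆ ∪ Above c D) ⊆ Above (h i) (image h)
    pointedTail⊆tail {D} i c D⊆ c∈ gap≤c y y∈ with ∪⁻ {⁅ c ⁆} {Above c D} y∈
    ... | inj₁ y∈⁅c⁆ = subst (_∈ Above (h i) (image h)) (sym (⁅⁆⁻ {c} {y} y∈⁅c⁆))
                               (image-tail h-increasing i c c∈ gap≤c)
    ... | inj₂ y∈Above with Above⁻ {c} {D} y∈Above
    ...   | y∈D , c<y = image-tail h-increasing i y (D⊆ y y∈D) (≤-trans gap≤c (<⇒≤ c<y))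

    no-uniform-reduction : ∀ C D → Infinite C → Infinite D → C ⊆ image evens → D ⊆ image evens →
                           ¬ (C ≤uiT D)
    no-uniform-reduction C D C-infinite D-infinite C⊆ D⊆ (Φ , uniform) = separate (C-infinite (suc gap))
      where
      open PointedTails uniform D-infinite
      i = 2 * ⌜ Φ ⌝
      gap = h (suc i)
      D⊆image : D ⊆ image h
      D⊆image = ⊆-trans D⊆ evens⊆image
      tail-homogeneous : Homogeneous (Positive Φ) (Above (h i) (image h))
      tail-homogeneous = h-homogeneous i Φ (s≤s (≤-trans (m≤n*m ⌜ Φ ⌝ 2) (inflationary i)))
      separate : (∃ λ c → suc gap ≤ c × c ∈ C) → ⊥
      separate (c , gap<c , c∈C) =
        not-homogeneous gap c tail-homogeneous (gap∉evens ⌜ Φ ⌝ ∘ C⊆ gap) c∈C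
          (pointedTail⊆tail i gap D⊆image (image⁺ (suc i)) ≤-refl)
          (pointedTail⊆tail i c D⊆image (evens⊆image c (C⊆ c c∈C)) (<⇒≤ gap<c))

proposition3p8 : ExcludedMiddle 0ℓ → (X : SetN) → Infinite X →
  ∃ λ (B : SetN) → B ⊆ X × Infinite B ×
    (∀ (C D : SetN) → Infinite C → Infinite D → C ⊆ B → D ⊆ B → ¬ (C ≤uiT D))
proposition3p8 em X X-infinite =
  thin (fusion (λ x → HomogeneousBelow-her (suc x)) (λ x → homogeneousBelow-dense (suc x)) X X-infinite)
  where
  open WithExcludedMiddle em
  open Diagonal em
  thin : ∃ (Fused (λ x → HomogeneousBelow (suc x)) X) →
         Thinning (λ B → ∀ C D → Infinite C → Infinite D → C ⊆ B → D ⊆ B → ¬ (C ≤uiT D)) X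
  thin (h , h-increasing , h∈X , h-homogeneous) =
    image evens , image-⊆ (λ k → h∈X (2 * k)) , image-infinite evens-increasing , no-uniform-reduction
    where open Thinned h-increasing h-homogeneous
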